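{- A connected graph $G$ is $1$-$\gamma_{\rm MB}$-critical if and only if $G$ is isomorphic to the star $K_{1,n}$ for some $n\ge 1$.
   Context: The Maker-Breaker domination (MBD) game on a graph $G$ is played by Dominator and Staller, who alternately select previously unselected vertices of $G$. Dominator wins if the set of vertices he has selected becomes a dominating set of $G$; Staller wins if she has selected at least one vertex of every dominating set of $G$. In the D-game Dominator moves first. $\gamma_{\rm MB}(G)$ is the minimum number $k$ such that Dominator has a strategy in the D-game guaranteeing that he wins having made at most $k$ moves, whatever Staller does; $\gamma_{\rm MB}(G)=\infty$ if Dominator has no winning strategy. A graph $G$ is $k$-$\gamma_{\rm MB}$-critical if $\gamma_{\rm MB}(G)=k$ and $\gamma_{\rm MB}(G)<\gamma_{\rm MB}(G-e)$ for every $e\in E(G)$. -}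

module Defs where

open import Level using (0ℓ)
open import Data.Nat using (ℕ; zero; suc; _<_; _≤_)
open import Data.Fin using (Fin; zero; suc)
open import Data.Fin.Subset using (Subset; _∈_; _∉_; _∪_; ⁅_⁆; ⊥)
open import Data.Product using (Σ; ∃; ∃-syntax; _×_; _,_; proj₁; proj₂)
open import Data.Sum using (_⊎_; inj₁; inj₂)
open import Relation.Nullary using (¬_)
open import Relation.Binary.PropositionalEquality using (_≡_; _≢_; refl)
open import Relation.Binary.Construct.Closure.ReflexiveTransitive using (Star)
open import Function.Bundles using (_↔_; Inverse)

record Graph (n : ℕ) : Set₁ where
  field
    Adj     : Fin n → Fin n → Set
    adj-sym : ∀ {x y} → Adj x y → Adj y x
    irrefl  : ∀ {x} → ¬ Adj x x
open Graph public

Connected : ∀ {n} → Graph n → Set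
Connected G = ∀ x y → Star (Adj G) x y

SameEdge : ∀ {n} → Fin n → Fin n → Fin n → Fin n → Set
SameEdge x y u v = (x ≡ u × y ≡ v) ⊎ (x ≡ v × y ≡ u)

deleteEdge : ∀ {n} → Graph n → Fin n → Fin n → Graph n
deleteEdge G u v = record
  { Adj    = λ x y → Adj G x y × ¬ SameEdge x y u v
  ; adj-sym = λ { (a , ne) → Graph.adj-sym G a , λ { (inj₁ (p , q)) → ne (inj₂ (q , p))
                                              ; (inj₂ (p , q)) → ne (inj₁ (q , p)) } }
  ; irrefl = λ { (a , _) → Graph.irrefl G a }
  }

Dominating : ∀ {n} → Graph n → Subset n → Set
Dominating G D = ∀ v → v ∈ D ⊎ ∃[ u ] (u ∈ D × Adj G u v)

Free : ∀ {n} → Subset n → Subset n → Fin n → Set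
Free D S v = v ∉ D × v ∉ S

-- DomWins G D S k : in the position where Dominator has selected D,
-- Staller has selected S and it is Dominator's turn, Dominator has a
-- strategy guaranteeing that his set becomes dominating after at most
-- k further moves of his, whatever Staller does.  (If after Dominator's
-- move his set is not dominating and no unselected vertex is left, the
-- game is over and Dominator has lost.)
DomWins : ∀ {n} → Graph n → Subset n → Subset n → ℕ → Set
DomWins G D S zero    = Dominating G D
DomWins G D S (suc k) =
  Dominating G D ⊎
  ∃[ v ] (Free D S v ×
          (Dominating G (D ∪ ⁅ v ⁆) ⊎
           ((∃[ u ] Free (D ∪ ⁅ v ⁆) S u) ×
            (∀ u → Free (D ∪ ⁅ v ⁆) S u → DomWins G (D ∪ ⁅ v ⁆) (S ∪ ⁅ u ⁆) k))))

WinsWithin : ∀ {n} → Graph n → ℕ → Set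
WinsWithin G k = DomWins G ⊥ ⊥ k

γMB≡ : ∀ {n} → Graph n → ℕ → Set
γMB≡ G k = WinsWithin G k × (∀ j → j < k → ¬ WinsWithin G j)

-- γ_MB(G) < γ_MB(H), with values in ℕ ∪ {∞}.
γMB< : ∀ {n m} → Graph n → Graph m → Set
γMB< G H = ∃[ k ] (WinsWithin G k × ¬ WinsWithin H k)

Critical : ∀ {n} → ℕ → Graph n → Set
Critical k G = γMB≡ G k × (∀ u v → Adj G u v → γMB< G (deleteEdge G u v))

Star-graph : (m : ℕ) → Graph (suc m)
Star-graph m = record
  { Adj    = λ x y → (x ≡ zero × y ≢ zero) ⊎ (y ≡ zero × x ≢ zero)
  ; adj-sym = λ { (inj₁ p) → inj₂ p ; (inj₂ p) → inj₁ p }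
  ; irrefl = λ { (inj₁ (p , q)) → q p ; (inj₂ (p , q)) → q p }
  }

Isomorphic : ∀ {n m} → Graph n → Graph m → Set
Isomorphic {n} {m} G H =
  Σ (Fin n ↔ Fin m) λ f →
    ∀ x y → (Adj G x y → Adj H (Inverse.to f x) (Inverse.to f y))
          × (Adj H (Inverse.to f x) (Inverse.to f y) → Adj G x y)

-- A single Dominator move wins exactly when some vertex w is universal, i.e. adjacent to all
-- others. If an edge xy misses w, then w is still universal in G - xy, so γ_MB(G - xy) = 1 and
-- G is not critical; hence every edge of a 1-critical graph contains w, which makes G a star
-- centred at w. Conversely, removing the edge wl from a star isolates the leaf l, after which no
-- single vertex dominates both w and l.
module Submission where

open import Defs
open import Data.Nat using (ℕ; zero; suc; _≤_; s≤s; z≤n)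
open import Data.Fin using (Fin; zero; _≟_)
open import Data.Fin.Subset using (_∈_; _∪_; ⁅_⁆; ⊥)
open import Data.Fin.Subset.Properties using (∉⊥; x∈⁅x⁆; x∈⁅y⁆⇒x≡y; x∈p∪q⁻; x∈p∪q⁺)
import Data.Fin.Permutation as Permutation
open import Data.Product using (∃-syntax; _×_; _,_; proj₁; proj₂)
open import Data.Sum using (_⊎_; inj₁; inj₂)
open import Data.Empty using (⊥-elim)
open import Function.Bundles using (_⇔_; mk⇔; Equivalence; _↔_; Inverse; Injection)
open import Function.Properties.Inverse using (Inverse⇒Injection)
open import Function.Construct.Symmetry using (↔-sym)
open import Relation.Nullary using (¬_; yes; no)
open import Relation.Binary.PropositionalEquality using (_≡_; _≢_; refl; sym; trans; subst; subst₂)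

private
  variable
    n m : ℕ

Universal : Graph n → Fin n → Set
Universal G w = ∀ y → y ≢ w → Adj G w y

StarCentred : Graph n → Fin n → Set
StarCentred G w = Universal G w × (∀ x y → Adj G x y → x ≡ w ⊎ y ≡ w)

∈⊥∪⁅⁆⇒≡ : ∀ {x v : Fin n} → x ∈ ⊥ ∪ ⁅ v ⁆ → x ≡ v
∈⊥∪⁅⁆⇒≡ {v = v} x∈ with x∈p∪q⁻ ⊥ ⁅ v ⁆ x∈
... | inj₁ x∈⊥ = ⊥-elim (∉⊥ x∈⊥)
... | inj₂ x∈⁅v⁆ = x∈⁅y⁆⇒x≡y v x∈⁅v⁆

≡⇒∈⊥∪⁅⁆ : ∀ {x v : Fin n} → x ≡ v → x ∈ ⊥ ∪ ⁅ v ⁆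
≡⇒∈⊥∪⁅⁆ {v = v} refl = x∈p∪q⁺ (inj₂ (x∈⁅x⁆ v))

dominating-⁅⁆⇔universal : (G : Graph n) (w : Fin n) →
                          Dominating G (⊥ ∪ ⁅ w ⁆) ⇔ Universal G w
dominating-⁅⁆⇔universal G w = mk⇔ universal dominating
  where
  universal : Dominating G (⊥ ∪ ⁅ w ⁆) → Universal G w
  universal dom y y≢w with dom y
  ... | inj₁ y∈ = ⊥-elim (y≢w (∈⊥∪⁅⁆⇒≡ y∈))
  ... | inj₂ (u , u∈ , adj) = subst (λ z → Adj G z y) (∈⊥∪⁅⁆⇒≡ u∈) adj

  dominating : Universal G w → Dominating G (⊥ ∪ ⁅ w ⁆)
  dominating univ y with y ≟ w
  ... | yes y≡w = inj₁ (≡⇒∈⊥∪⁅⁆ y≡w)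
  ... | no y≢w = inj₂ (w , ≡⇒∈⊥∪⁅⁆ refl , univ y y≢w)

¬dominating-⊥ : (G : Graph n) → Fin n → ¬ Dominating G ⊥
¬dominating-⊥ G x dom with dom x
... | inj₁ x∈⊥ = ∉⊥ x∈⊥
... | inj₂ (_ , u∈⊥ , _) = ∉⊥ u∈⊥

¬winsWithin-0 : (G : Graph n) → Fin n → ¬ WinsWithin G 0
¬winsWithin-0 = ¬dominating-⊥

universal⇒winsWithin-suc : (G : Graph n) {w : Fin n} → Universal G w →
                           ∀ k → WinsWithin G (suc k)
universal⇒winsWithin-suc G {w} univ k =
  inj₂ (w , (∉⊥ , ∉⊥) , inj₁ (Equivalence.from (dominating-⁅⁆⇔universal G w) univ))

-- Whatever Staller answers, Dominator's first vertex must already dominate on its own.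
winsWithin-1⇒dominating-⁅⁆ : (G : Graph n) → Fin n → WinsWithin G 1 →
                             ∃[ w ] Dominating G (⊥ ∪ ⁅ w ⁆)
winsWithin-1⇒dominating-⁅⁆ G x (inj₁ dom) = ⊥-elim (¬dominating-⊥ G x dom)
winsWithin-1⇒dominating-⁅⁆ G x (inj₂ (w , _ , inj₁ dom)) = w , dom
winsWithin-1⇒dominating-⁅⁆ G x (inj₂ (w , _ , inj₂ ((u , free) , reply))) = w , reply u free

winsWithin-1⇒universal : (G : Graph n) → Fin n → WinsWithin G 1 → ∃[ w ] Universal G w
winsWithin-1⇒universal G x win with winsWithin-1⇒dominating-⁅⁆ G x win
... | w , dom = w , Equivalence.to (dominating-⁅⁆⇔universal G w) dom

universal-deleteEdge : (G : Graph n) {w x y : Fin n} → Universal G w → x ≢ w → y ≢ w →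
                       Universal (deleteEdge G x y) w
universal-deleteEdge G univ x≢w y≢w z z≢w = univ z z≢w , λ where
  (inj₁ (w≡x , _)) → x≢w (sym w≡x)
  (inj₂ (w≡y , _)) → y≢w (sym w≡y)

critical-1⇒starCentred : (G : Graph n) → Fin n → Critical 1 G → ∃[ w ] StarCentred G w
critical-1⇒starCentred G x₀ ((win , _) , critical) with winsWithin-1⇒universal G x₀ win
... | w , univ = w , univ , edge-meets-centre
  where
  edge-meets-centre : ∀ x y → Adj G x y → x ≡ w ⊎ y ≡ w
  edge-meets-centre x y adj with x ≟ w | y ≟ w
  ... | yes x≡w | _ = inj₁ x≡w
  ... | no _ | yes y≡w = inj₂ y≡w
  ... | no x≢w | no y≢w with critical x y adj
  ...   | zero , win₀ , _ = ⊥-elim (¬winsWithin-0 G x win₀)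
  ...   | suc k , _ , ¬win = ⊥-elim (¬win (universal⇒winsWithin-suc (deleteEdge G x y)
                                             (universal-deleteEdge G univ x≢w y≢w) k))

SameEdge-swap : ∀ {x y u v : Fin n} → SameEdge x y u v → SameEdge y x u v
SameEdge-swap (inj₁ (x≡u , y≡v)) = inj₂ (y≡v , x≡u)
SameEdge-swap (inj₂ (x≡v , y≡u)) = inj₁ (y≡u , x≡v)

starCentred-edge⇒leaf : (G : Graph n) {w x y : Fin n} → StarCentred G w → Adj G x y →
                        ∃[ l ] (l ≢ w × SameEdge w l x y)
starCentred-edge⇒leaf G {x = x} {y} (_ , meets) adj with meets x y adj
... | inj₁ refl = y , (λ { refl → irrefl G adj }) , inj₁ (refl , refl)
... | inj₂ refl = x , (λ { refl → irrefl G adj }) , inj₂ (refl , refl)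

starCentred⇒¬universal-deleteEdge : (G : Graph n) {w l x y : Fin n} → StarCentred G w →
                                    l ≢ w → SameEdge w l x y →
                                    ∀ v → ¬ Universal (deleteEdge G x y) v
starCentred⇒¬universal-deleteEdge G {w} {l} (_ , meets) l≢w wl≈xy v univ with v ≟ l
... | yes refl = proj₂ (univ w (λ w≡l → l≢w (sym w≡l))) (SameEdge-swap wl≈xy)
... | no v≢l with univ l (λ l≡v → v≢l (sym l≡v))
...   | adj , ¬vl≈xy with meets v l adj
...     | inj₁ refl = ¬vl≈xy wl≈xy
...     | inj₂ l≡w = l≢w l≡w

starCentred⇒critical-1 : (G : Graph n) {w : Fin n} → StarCentred G w → Critical 1 G
starCentred⇒critical-1 G {w} star@(univ , _) =
  (win , λ { zero _ → ¬winsWithin-0 G w ; (suc _) (s≤s ()) }) ,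
  λ x y adj → 1 , win , ¬win-deleted x y adj
  where
  win : WinsWithin G 1
  win = universal⇒winsWithin-suc G univ 0

  ¬win-deleted : ∀ x y → Adj G x y → ¬ WinsWithin (deleteEdge G x y) 1
  ¬win-deleted x y adj win′ with starCentred-edge⇒leaf G star adj
                                | winsWithin-1⇒universal (deleteEdge G x y) w win′
  ... | l , l≢w , wl≈xy | v , univ′ =
    starCentred⇒¬universal-deleteEdge G star l≢w wl≈xy v univ′

star-graph-starCentred : ∀ m → StarCentred (Star-graph m) zero
star-graph-starCentred m = (λ y y≢0 → inj₁ (refl , y≢0)) , λ where
  _ _ (inj₁ (x≡0 , _)) → inj₁ x≡0
  _ _ (inj₂ (y≡0 , _)) → inj₂ y≡0

isomorphic-starCentred : (G : Graph n) (H : Graph m) {c : Fin m} →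
                         ((f , _) : Isomorphic G H) → StarCentred H c →
                         StarCentred G (Inverse.from f c)
isomorphic-starCentred G H {c} (f , iso) (univ , meets) = univ′ , meets′
  where
  open Inverse f

  to≡c⇒≡from : ∀ {x} → to x ≡ c → x ≡ from c
  to≡c⇒≡from tox≡c = sym (inverseʳ (sym tox≡c))

  univ′ : Universal G (from c)
  univ′ y y≢from-c = proj₂ (iso (from c) y)
    (subst (λ z → Adj H z (to y)) (sym (strictlyInverseˡ c))
           (univ (to y) (λ toy≡c → y≢from-c (to≡c⇒≡from toy≡c))))

  meets′ : ∀ x y → Adj G x y → x ≡ from c ⊎ y ≡ from c
  meets′ x y adj with meets (to x) (to y) (proj₁ (iso x y) adj)
  ... | inj₁ tox≡c = inj₁ (to≡c⇒≡from tox≡c)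
  ... | inj₂ toy≡c = inj₂ (to≡c⇒≡from toy≡c)

centre-adj-preserved : (G : Graph n) (H : Graph m) {w : Fin n} {c : Fin m} → Universal H c →
                       (f : Fin n ↔ Fin m) → Inverse.to f w ≡ c →
                       ∀ {y} → Adj G w y → Adj H (Inverse.to f w) (Inverse.to f y)
centre-adj-preserved G H {w} {c} univ f fw≡c {y} adj =
  subst (λ z → Adj H z (to y)) (sym fw≡c) (univ (to y) fy≢c)
  where
  open Inverse f
  fy≢c : to y ≢ c
  fy≢c fy≡c = irrefl G (subst (Adj G w) y≡w adj)
    where y≡w = Injection.injective (Inverse⇒Injection f) (trans fy≡c (sym fw≡c))

starCentred⇒adj-preserved : (G : Graph n) (H : Graph m) {w : Fin n} {c : Fin m} →
                            StarCentred G w → StarCentred H c →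
                            (f : Fin n ↔ Fin m) → Inverse.to f w ≡ c →
                            ∀ {x y} → Adj G x y → Adj H (Inverse.to f x) (Inverse.to f y)
starCentred⇒adj-preserved G H (_ , meets) (univ , _) f fw≡c {x} {y} adj with meets x y adj
... | inj₁ refl = centre-adj-preserved G H univ f fw≡c adj
... | inj₂ refl = adj-sym H (centre-adj-preserved G H univ f fw≡c (adj-sym G adj))

-- Adjacency is reflected because f⁻¹ also maps centre to centre.
starCentred⇒isomorphic : (G : Graph n) (H : Graph m) {w : Fin n} {c : Fin m} →
                         StarCentred G w → StarCentred H c →
                         (f : Fin n ↔ Fin m) → Inverse.to f w ≡ c → Isomorphic G H
starCentred⇒isomorphic G H starG starH f fw≡c =
  f , λ x y → starCentred⇒adj-preserved G H starG starH f fw≡c , reflects x y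
  where
  open Inverse f
  reflects : ∀ x y → Adj H (to x) (to y) → Adj G x y
  reflects x y adj = subst₂ (Adj G) (strictlyInverseʳ x) (strictlyInverseʳ y)
    (starCentred⇒adj-preserved H G starH starG (↔-sym f) (inverseʳ (sym fw≡c)) adj)

starCentred⇒isomorphic-star : (G : Graph (suc n)) {w : Fin (suc n)} → StarCentred G w →
                              Isomorphic G (Star-graph n)
starCentred⇒isomorphic-star {n} G {w} star =
  starCentred⇒isomorphic G (Star-graph n) star (star-graph-starCentred n)
                         swap (Inverse.strictlyInverseˡ swap zero)
  where
  swap : Fin (suc n) ↔ Fin (suc n)
  swap = Permutation.transpose w zero

proposition4p1 : ∀ {n} (G : Graph n) → 2 ≤ n → Connected G →
    (Critical 1 G ⇔ (∃[ m ] (1 ≤ m × Isomorphic G (Star-graph m))))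
proposition4p1 {suc (suc n)} G (s≤s (s≤s z≤n)) _ = mk⇔ star-of-critical critical-of-star
  where
  star-of-critical : Critical 1 G → ∃[ m ] (1 ≤ m × Isomorphic G (Star-graph m))
  star-of-critical critical with critical-1⇒starCentred G zero critical
  ... | _ , star = suc n , s≤s z≤n , starCentred⇒isomorphic-star G star

  critical-of-star : ∃[ m ] (1 ≤ m × Isomorphic G (Star-graph m)) → Critical 1 G
  critical-of-star (m , _ , iso) =
    starCentred⇒critical-1 G
      (isomorphic-starCentred G (Star-graph m) iso (star-graph-starCentred m))
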